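{- For every positive integer $h$ there exists $n_0$ such that for all $n\geq n_0$, $\mathrm{nim}_2(n, K_{1,h})= ex(n, K_{1,h})$.
   Context: $K_{1,h}$ is the star with $h$ edges. $ex(n,H)$ is the Turán number: the maximum number of edges in an $n$-vertex graph containing no copy of $H$. $\mathrm{nim}_k(n,H)$ is the maximum, over all edge-colorings of $K_n$ with colors from $[k]$, of the number of edges of $K_n$ not contained in any monochromatic copy of $H$ (a copy all of whose edges have the same color). -}

module Defs where

open import Data.Nat using (ℕ; zero; suc; _≤_)
open import Data.Fin using (Fin; _<?_; _<_)
import Data.Fin as F
open import Data.Bool using (Bool; true; false; T; T?; not)
open import Data.List using (List; length; filter; map; concatMap; allFin)
open import Data.List.Membership.Propositional using (_∈_)
open import Data.List.Relation.Unary.Unique.Propositional using (Unique)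
open import Data.Product using (Σ; ∃; _×_; _,_; proj₁; proj₂)
open import Relation.Binary.PropositionalEquality using (_≡_)
open import Relation.Nullary using (¬_)
open import Function.Definitions using (Injective)
open import Function using (_⇔_)

record Graph (n : ℕ) : Set where
  field
    adj   : Fin n → Fin n → Bool
    sym   : ∀ u v → adj u v ≡ adj v u
    irrefl : ∀ u → adj u u ≡ false
open Graph public

pairs : (n : ℕ) → List (Fin n × Fin n)
pairs n = concatMap (λ i → map (λ j → (i , j)) (filter (λ j → i <? j) (allFin n))) (allFin n)

edges : ∀ {n} → Graph n → ℕ
edges {n} G = length (filter (λ p → T? (adj G (proj₁ p) (proj₂ p))) (pairs n))

-- The star K_{1,h}: vertex 0 is the centre, joined to the h leaves.
isZero : ∀ {k} → Fin k → Bool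
isZero F.zero = true
isZero (F.suc _) = false

xor : Bool → Bool → Bool
xor true b = not b
xor false b = b

star : (h : ℕ) → Graph (suc h)
star h = record { adj = λ a b → xor (isZero a) (isZero b) ; sym = s ; irrefl = ir }
  where
  s : ∀ a b → xor (isZero a) (isZero b) ≡ xor (isZero b) (isZero a)
  s F.zero F.zero = _≡_.refl
  s F.zero (F.suc b) = _≡_.refl
  s (F.suc a) F.zero = _≡_.refl
  s (F.suc a) (F.suc b) = _≡_.refl
  ir : ∀ a → xor (isZero a) (isZero a) ≡ false
  ir F.zero = _≡_.refl
  ir (F.suc a) = _≡_.refl

-- A copy of H (on Fin k) in G (on Fin n): an injective edge-preserving vertex map
-- (H need not be induced).
Copy : ∀ {k n} → Graph k → Graph n → Set
Copy {k} {n} H G = Σ (Fin k → Fin n) λ f →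
  Injective _≡_ _≡_ f × (∀ a b → T (adj H a b) → T (adj G (f a) (f b)))

HFree : ∀ {k n} → Graph k → Graph n → Set
HFree H G = ¬ Copy H G

IsEx : ∀ {k} → ℕ → Graph k → ℕ → Set
IsEx n H m =
  (Σ (Graph n) λ G → HFree H G × edges G ≡ m) ×
  (∀ (G : Graph n) → HFree H G → edges G ≤ m)

-- An edge-colouring of K_n with colours from [r] (= Fin r), given as a symmetric
-- function on ordered pairs (its values on the diagonal are irrelevant).
record Colouring (r n : ℕ) : Set where
  field
    col    : Fin n → Fin n → Fin r
    colSym : ∀ u v → col u v ≡ col v u
open Colouring public

MonoCopy : ∀ {r k n} → Colouring r n → Graph k → Fin r → Set
MonoCopy {r} {k} {n} χ H c = Σ (Fin k → Fin n) λ f →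
  Injective _≡_ _≡_ f × (∀ a b → T (adj H a b) → col χ (f a) (f b) ≡ c)

InMonoCopy : ∀ {r k n} → Colouring r n → Graph k → Fin n → Fin n → Set
InMonoCopy {r} {k} {n} χ H u v = Σ (Fin r) λ c → Σ (MonoCopy χ H c) λ φ →
  Σ (Fin k) λ a → Σ (Fin k) λ b →
    T (adj H a b) × proj₁ φ a ≡ u × proj₁ φ b ≡ v

NimCount : ∀ {r k n} → Colouring r n → Graph k → ℕ → Set
NimCount {r} {k} {n} χ H m = Σ (List (Fin n × Fin n)) λ L →
  Unique L × length L ≡ m ×
  (∀ u v → ((u , v) ∈ L) ⇔ ((u < v) × ¬ InMonoCopy χ H u v))

IsNim : ∀ {k} → ℕ → ℕ → Graph k → ℕ → Set
IsNim r n H m =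
  (Σ (Colouring r n) λ χ → NimCount χ H m) ×
  (∀ (χ : Colouring r n) m' → NimCount χ H m' → m' ≤ m)

-- Call an edge of a coloured K_n NIM if it lies in no monochromatic copy of
-- S = K_{1,h}.  Fix n ≥ 2h and an extremal S-free graph G on n vertices.
--   * Lower bound.  Colour the edges of G red and all other edges blue.  A
--     monochromatic copy of S through an edge of G is red, i.e. a copy of S in
--     G; so every edge of G is NIM.
--   * Upper bound.  Under any 2-colouring the graph of NIM edges is S-free:
--     at a vertex c the n-1 ≥ 2h-1 other vertices split into two colour
--     classes, one of which, say κ, has at least h members, and then every
--     κ-edge at c lies in a monochromatic star.  So the NIM edges at c avoid κ,
--     all have the other colour, and h of them would form a monochromatic star.

module Submission where

open import Data.Nat using (ℕ; zero; suc; _≤_; _+_; s≤s; _≤?_)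
open import Data.Nat.Properties
  using (≤-trans; ≤-antisym; ≤∧≢⇒<; ≤-pred; ≰⇒>; +-mono-≤; +-suc; 1+n≰n; module ≤-Reasoning)
import Data.Nat as ℕ
open import Data.Fin using (Fin; _<_; _<?_; _≟_; inject≤)
import Data.Fin as F
open import Data.Fin.Properties using (any?; all?; injective⇒≤; inject≤-injective; <⇒≢)
open import Data.Bool using (Bool; true; false; T; T?; if_then_else_)
import Data.Bool.Properties as Bool
open import Data.List using (List; _∷_; _++_; length; filter; map; lookup; allFin)
open import Data.List.Properties using (length-filter; length-++; length-tabulate; filter-≐; filter-none)
open import Data.List.Membership.Propositional using (_∈_)
open import Data.List.Membership.Propositional.Properties
  using ( ∈-lookup; ∈-filter⁺; ∈-filter⁻; ∈-map⁺; ∈-map⁻; ∈-concatMap⁺; ∈-concatMap⁻; ∈-allFin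
        ; ∈-++⁺ˡ; ∈-++⁺ʳ)
open import Data.List.Membership.Setoid.Properties using (index-injective)
open import Data.List.Relation.Unary.Any using (here; there)
import Data.List.Relation.Unary.Any as Any
import Data.List.Relation.Unary.All as All
import Data.List.Relation.Unary.All.Properties as All
import Data.List.Relation.Unary.AllPairs as AllPairs
import Data.List.Relation.Unary.AllPairs.Properties as AllPairs
open import Data.List.Relation.Unary.AllPairs using (_∷_)
open import Data.List.Relation.Unary.Unique.Propositional using (Unique)
import Data.List.Relation.Unary.Unique.Propositional.Properties as Unique
open import Data.Vec.Functional using (head; tail) renaming (_∷_ to _◂_)
open import Data.Vec.Functional.Relation.Binary.Pointwise using (Pointwise)
open import Data.Product using (Σ; _×_; _,_; proj₁; proj₂)
open import Data.Unit using (tt)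
open import Data.Empty using (⊥-elim)
open import Function using (_∘_; _⇔_; mk⇔; Equivalence)
open import Function.Definitions using (Injective)
open import Relation.Binary.PropositionalEquality
  using (_≡_; _≢_; refl; sym; trans; cong; subst; subst₂; setoid)
open import Relation.Nullary using (¬_; Dec; yes; no; ¬?)
open import Relation.Nullary.Decidable
  using (map′; _×-dec_; _→-dec_; isYes; toWitness; fromWitness; isYes≗does; does-⇔; dec-false)
open import Defs renaming (sym to adj-sym; irrefl to adj-irrefl)

lookup-injective : ∀ {A : Set} {xs : List A} → Unique xs → Injective _≡_ _≡_ (lookup xs)
lookup-injective {xs = x ∷ xs} (_ ∷ _) {F.zero} {F.zero} _ = refl
lookup-injective {xs = x ∷ xs} (x∉xs ∷ _) {F.zero} {F.suc j} eq = ⊥-elim (All.lookup x∉xs (∈-lookup j) eq)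
lookup-injective {xs = x ∷ xs} (x∉xs ∷ _) {F.suc i} {F.zero} eq =
  ⊥-elim (All.lookup x∉xs (∈-lookup i) (sym eq))
lookup-injective {xs = x ∷ xs} (_ ∷ uxs) {F.suc i} {F.suc j} eq = cong F.suc (lookup-injective uxs eq)

-- A duplicate-free list is no longer than any list containing all its entries:
-- the position of each entry in the bigger list is an injection of positions.
unique-⊆-length : ∀ {A : Set} {xs ys : List A} → Unique xs → (∀ {x} → x ∈ xs → x ∈ ys) →
  length xs ≤ length ys
unique-⊆-length {A} {xs} {ys} uxs xs⊆ys = injective⇒≤ position-injective
  where
  position : Fin (length xs) → Fin (length ys)
  position i = Any.index (xs⊆ys (∈-lookup i))
  position-injective : Injective _≡_ _≡_ position
  position-injective {i} {j} eq =
    lookup-injective uxs (index-injective (setoid A) (xs⊆ys (∈-lookup i)) (xs⊆ys (∈-lookup j)) eq)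

pick : ∀ {A : Set} {xs : List A} {k} → Unique xs → k ≤ length xs →
  Σ (Fin k → A) λ g → Injective _≡_ _≡_ g × (∀ i → g i ∈ xs)
pick {xs = xs} uxs k≤ =
  (λ i → lookup xs (inject≤ i k≤)) ,
  (λ eq → inject≤-injective k≤ k≤ _ _ (lookup-injective uxs eq)) ,
  (λ i → ∈-lookup (inject≤ i k≤))

Searchable : (A : Set) → (A → A → Set) → Set₁
Searchable A _≈_ = ∀ (P : A → Set) → (∀ {x y} → x ≈ y → P x → P y) → (∀ x → Dec (P x)) →
  Dec (Σ A P)

search-Fin : ∀ n → Searchable (Fin n) _≡_
search-Fin n P _ P? = any? P?

search-Bool : Searchable Bool _≡_
search-Bool P _ P? with P? true | P? false
... | yes p  | _      = yes (true , p)
... | no _   | yes p  = yes (false , p)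
... | no ¬pt | no ¬pf = no λ { (true , p) → ¬pt p ; (false , p) → ¬pf p }

-- Functions Fin k → A (up to pointwise equivalence) are searchable if A is:
-- search for the head, and recursively for a tail completing it.
search-Vector : ∀ {A : Set} {_≈_ : A → A → Set} → (∀ x → x ≈ x) → Searchable A _≈_ →
  ∀ k → Searchable (Fin k → A) (Pointwise _≈_)
search-Vector {A} ≈-refl search-A zero P resp P? =
  map′ (λ p → empty , p) (λ (f , p) → resp (λ ()) p) (P? empty)
  where
  empty : Fin 0 → A
  empty ()
search-Vector {A} {_≈_} ≈-refl search-A (suc k) P resp P? =
  map′ (λ (x , g , p) → x ◂ g , p) (λ (f , p) → head f , tail f , resp (η f) p) (search-A Q resp-Q Q?)
  where
  Q : A → Set
  Q x = Σ (Fin k → A) λ g → P (x ◂ g)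
  Q? : ∀ x → Dec (Q x)
  Q? x = search-Vector ≈-refl search-A k (λ g → P (x ◂ g))
    (λ g≈g′ → resp λ { F.zero → ≈-refl x ; (F.suc i) → g≈g′ i }) (λ g → P? (x ◂ g))
  resp-Q : ∀ {x y} → x ≈ y → Q x → Q y
  resp-Q x≈y (g , p) = g , resp (λ { F.zero → x≈y ; (F.suc i) → ≈-refl (g i) }) p
  η : ∀ f → Pointwise _≈_ f (head f ◂ tail f)
  η f F.zero = ≈-refl _
  η f (F.suc i) = ≈-refl _

search-maps : ∀ k n → Searchable (Fin k → Fin n) (Pointwise _≡_)
search-maps k n = search-Vector (λ _ → refl) (search-Fin n) k

bounded-max : (Q : ℕ → Set) → (∀ k → Dec (Q k)) → ∀ B → (∀ k → Q k → k ≤ B) → Q 0 →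
  Σ ℕ λ m → Q m × (∀ k → Q k → k ≤ m)
bounded-max Q Q? zero bounded q₀ = 0 , q₀ , bounded
bounded-max Q Q? (suc B) bounded q₀ with Q? (suc B)
... | yes q = suc B , q , bounded
... | no ¬q = bounded-max Q Q? B (λ k qk → ≤-pred (≤∧≢⇒< (bounded k qk) λ { refl → ¬q qk })) q₀

pairs-∈⁻ : ∀ {n} {u v : Fin n} → (u , v) ∈ pairs n → u < v
pairs-∈⁻ {n} m with Any.satisfied (∈-concatMap⁻ _ {xs = allFin n} m)
... | i , m′ with ∈-map⁻ _ m′
... | j , j∈ , refl = proj₂ (∈-filter⁻ (λ j → i <? j) {xs = allFin n} j∈)

pairs-∈⁺ : ∀ {n} {u v : Fin n} → u < v → (u , v) ∈ pairs n
pairs-∈⁺ {n} {u} {v} u<v = ∈-concatMap⁺ _ {xs = allFin n}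
  (Any.map (λ { refl → ∈-map⁺ _ (∈-filter⁺ (λ j → u <? j) (∈-allFin v) u<v) }) (∈-allFin u))

-- No pair is repeated: the rows of distinct first coordinates are disjoint.
pairs-unique : ∀ n → Unique (pairs n)
pairs-unique n = Unique.concat⁺
  (All.map⁺ (All.tabulate λ {i} _ →
    Unique.map⁺ (cong proj₂) (Unique.filter⁺ (λ j → i <? j) (Unique.allFin⁺ n))))
  (AllPairs.map⁺ (AllPairs.map disjoint (Unique.allFin⁺ n)))
  where
  row : Fin n → List (Fin n × Fin n)
  row i = map (λ j → (i , j)) (filter (λ j → i <? j) (allFin n))
  disjoint : ∀ {i j} → i ≢ j → ∀ {p} → ¬ (p ∈ row i × p ∈ row j)
  disjoint i≢j (p∈i , p∈j) with ∈-map⁻ _ p∈i | ∈-map⁻ _ p∈j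
  ... | _ , _ , refl | _ , _ , eq = i≢j (cong proj₁ eq)

edgeList : ∀ {n} → Graph n → List (Fin n × Fin n)
edgeList {n} G = filter (λ p → T? (adj G (proj₁ p) (proj₂ p))) (pairs n)

edgeList-unique : ∀ {n} (G : Graph n) → Unique (edgeList G)
edgeList-unique {n} G = Unique.filter⁺ _ (pairs-unique n)

∈-edgeList : ∀ {n} (G : Graph n) u v → ((u , v) ∈ edgeList G) ⇔ (u < v × T (adj G u v))
∈-edgeList {n} G u v = mk⇔
  (λ m → let m′ , uv = ∈-filter⁻ edge? {xs = pairs n} m in pairs-∈⁻ m′ , uv)
  (λ (u<v , uv) → ∈-filter⁺ edge? (pairs-∈⁺ u<v) uv)
  where
  edge? : ∀ p → Dec (T (adj G (proj₁ p) (proj₂ p)))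
  edge? p = T? (adj G (proj₁ p) (proj₂ p))

edges-mono : ∀ {n} {G G′ : Graph n} → (∀ u v → T (adj G u v) → T (adj G′ u v)) → edges G ≤ edges G′
edges-mono {G = G} {G′} G⊆G′ = unique-⊆-length (edgeList-unique G) λ { {u , v} m →
  let u<v , uv = Equivalence.to (∈-edgeList G u v) m in
  Equivalence.from (∈-edgeList G′ u v) (u<v , G⊆G′ u v uv) }

_≈ᴳ_ : ∀ {n} → Graph n → Graph n → Set
G ≈ᴳ G′ = ∀ u v → adj G u v ≡ adj G′ u v

edges-resp : ∀ {n} {G G′ : Graph n} → G ≈ᴳ G′ → edges G ≡ edges G′
edges-resp {n} {G} {G′} G≈G′ = cong length (filter-≐ _ _
  ( (λ {p} → subst T (G≈G′ (proj₁ p) (proj₂ p)))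
  , (λ {p} → subst T (sym (G≈G′ (proj₁ p) (proj₂ p)))))
  (pairs n))

-- Graphs on Fin n, up to ≈ᴳ, can be searched exhaustively: search their
-- adjacency functions, keeping those that are symmetric and irreflexive.
search-Graph : ∀ n → Searchable (Graph n) _≈ᴳ_
search-Graph n P resp P? =
  map′ (λ (a , g , p) → graph a g , p) underlying
    (search-Vector (λ _ _ → refl) (search-Vector (λ _ → refl) search-Bool n) n Q resp-Q Q?)
  where
  IsGraph : (Fin n → Fin n → Bool) → Set
  IsGraph a = (∀ u v → a u v ≡ a v u) × (∀ u → a u u ≡ false)
  isGraph? : ∀ a → Dec (IsGraph a)
  isGraph? a = (all? λ u → all? λ v → a u v Bool.≟ a v u) ×-dec (all? λ u → a u u Bool.≟ false)
  graph : ∀ a → IsGraph a → Graph n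
  graph a (a-sym , a-irrefl) = record { adj = a ; sym = a-sym ; irrefl = a-irrefl }
  Q : (Fin n → Fin n → Bool) → Set
  Q a = Σ (IsGraph a) λ g → P (graph a g)
  resp-Q : ∀ {a a′} → (∀ u v → a u v ≡ a′ u v) → Q a → Q a′
  resp-Q {a} {a′} a≈a′ ((a-sym , a-irrefl) , p) = g′ , resp a≈a′ p
    where
    g′ : IsGraph a′
    g′ = (λ u v → trans (sym (a≈a′ u v)) (trans (a-sym u v) (a≈a′ v u))) ,
         (λ u → trans (sym (a≈a′ u u)) (a-irrefl u))
  underlying : Σ (Graph n) P → Σ (Fin n → Fin n → Bool) Q
  underlying (G , p) = adj G , (adj-sym G , adj-irrefl G) , p
  Q? : ∀ a → Dec (Q a)
  Q? a with isGraph? a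
  ... | yes g = map′ (g ,_) (λ (g′ , p) → resp (λ _ _ → refl) p) (P? (graph a g))
  ... | no ¬g = no (¬g ∘ proj₁)

-- A copy of H in G is an embedding along the adjacency of G,
-- a monochromatic copy one along "has colour c".
Embedding : ∀ {k n} → Graph k → (Fin n → Fin n → Set) → (Fin k → Fin n) → Set
Embedding H R f = Injective _≡_ _≡_ f × (∀ a b → T (adj H a b) → R (f a) (f b))

embedding-resp : ∀ {k n} {H : Graph k} {R : Fin n → Fin n → Set} {f g : Fin k → Fin n} →
  Pointwise _≡_ f g → Embedding H R f → Embedding H R g
embedding-resp {R = R} f≗g (f-inj , f-edges) =
  (λ eq → f-inj (trans (f≗g _) (trans eq (sym (f≗g _))))) ,
  (λ a b ab → subst₂ R (f≗g a) (f≗g b) (f-edges a b ab))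

embedding? : ∀ {k n} (H : Graph k) {R : Fin n → Fin n → Set} → (∀ u v → Dec (R u v)) →
  ∀ f → Dec (Embedding H R f)
embedding? H R? f = injective? ×-dec (all? λ a → all? λ b → T? (adj H a b) →-dec R? (f a) (f b))
  where
  injective? : Dec (Injective _≡_ _≡_ f)
  injective? = map′ (λ inj {x} {y} → inj x y) (λ inj x y → inj)
    (all? λ x → all? λ y → (f x ≟ f y) →-dec (x ≟ y))

copy? : ∀ {k n} (H : Graph k) (G : Graph n) → Dec (Copy H G)
copy? {k} {n} H G = search-maps k n (Embedding H (λ u v → T (adj G u v)))
  (embedding-resp {H = H} {R = λ u v → T (adj G u v)})
  (embedding? H λ u v → T? (adj G u v))

copy-resp : ∀ {k n} {H : Graph k} {G G′ : Graph n} → G ≈ᴳ G′ → Copy H G → Copy H G′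
copy-resp G≈G′ (f , f-inj , f-edges) = f , f-inj , λ a b ab → subst T (G≈G′ _ _) (f-edges a b ab)

HasColour : ∀ {r n} → Colouring r n → Fin r → Fin n → Fin n → Set
HasColour χ c u v = col χ u v ≡ c

EdgeAt : ∀ {k n} → Graph k → (Fin k → Fin n) → Fin n → Fin n → Set
EdgeAt {k} H f u v = Σ (Fin k) λ a → Σ (Fin k) λ b → T (adj H a b) × f a ≡ u × f b ≡ v

inMonoCopy? : ∀ {r k n} (χ : Colouring r n) (H : Graph k) u v → Dec (InMonoCopy χ H u v)
inMonoCopy? {r} {k} {n} χ H u v =
  map′ (λ (c , f , emb , at) → c , (f , emb) , at) (λ (c , (f , emb) , at) → c , f , emb , at)
    (any? λ c → search-maps k n (MonoEdge c) (resp c) (MonoEdge? c))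
  where
  MonoEdge : Fin r → (Fin k → Fin n) → Set
  MonoEdge c f = Embedding H (HasColour χ c) f × EdgeAt H f u v
  MonoEdge? : ∀ c f → Dec (MonoEdge c f)
  MonoEdge? c f = embedding? H (λ x y → col χ x y ≟ c) f ×-dec
    (any? λ a → any? λ b → T? (adj H a b) ×-dec (f a ≟ u) ×-dec (f b ≟ v))
  resp : ∀ c {f g} → Pointwise _≡_ f g → MonoEdge c f → MonoEdge c g
  resp c f≗g (emb , a , b , ab , fa≡u , fb≡v) =
    embedding-resp {H = H} {R = HasColour χ c} f≗g emb ,
    a , b , ab , trans (sym (f≗g a)) fa≡u , trans (sym (f≗g b)) fb≡v

inMonoCopy-sym : ∀ {r k n} {χ : Colouring r n} {H : Graph k} {u v} →
  InMonoCopy χ H u v → InMonoCopy χ H v u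
inMonoCopy-sym {H = H} (c , φ , a , b , ab , fa≡u , fb≡v) =
  c , φ , b , a , subst T (adj-sym H a b) ab , fb≡v , fa≡u

-- Turán numbers exist for every graph H with an edge: the empty graph is
-- H-free, and among the H-free graphs the number of edges is bounded.
ex-exists : ∀ {k} (H : Graph k) → (Σ (Fin k) λ a → Σ (Fin k) λ b → T (adj H a b)) →
  ∀ n → Σ ℕ λ m → IsEx n H m
ex-exists {k} H (a , b , ab) n with bounded-max HasFree HasFree? (length (pairs n)) bounded has₀
  where
  HasFree : ℕ → Set
  HasFree m = Σ (Graph n) λ G → HFree H G × edges G ≡ m
  HasFree? : ∀ m → Dec (HasFree m)
  HasFree? m = search-Graph n (λ G → HFree H G × edges G ≡ m) (λ {G} {G′} → resp {G} {G′})
    (λ G → ¬? (copy? H G) ×-dec (edges G ℕ.≟ m))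
    where
    resp : ∀ {G G′} → G ≈ᴳ G′ → HFree H G × edges G ≡ m → HFree H G′ × edges G′ ≡ m
    resp {G} {G′} G≈G′ (free , e) =
      free ∘ copy-resp {H = H} {G = G′} {G′ = G} (λ u v → sym (G≈G′ u v)) ,
      trans (sym (edges-resp {G = G} {G′ = G′} G≈G′)) e
  bounded : ∀ m → HasFree m → m ≤ length (pairs n)
  bounded _ (G , _ , refl) = length-filter _ (pairs n)
  empty : Graph n
  empty = record { adj = λ _ _ → false ; sym = λ _ _ → refl ; irrefl = λ _ → refl }
  has₀ : HasFree 0
  has₀ = empty , (λ (f , _ , f-edges) → f-edges a b ab) ,
    cong length (filter-none _ (All.universal (λ _ ()) (pairs n)))
... | m , witness , maximal = m , witness , λ G free → maximal (edges G) (G , free , refl)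

NimEdge : ∀ {r k n} → Colouring r n → Graph k → Fin n → Fin n → Set
NimEdge χ H u v = u ≢ v × ¬ InMonoCopy χ H u v

nimEdge? : ∀ {r k n} (χ : Colouring r n) (H : Graph k) u v → Dec (NimEdge χ H u v)
nimEdge? χ H u v = ¬? (u ≟ v) ×-dec ¬? (inMonoCopy? χ H u v)

nimEdge-sym : ∀ {r k n} (χ : Colouring r n) (H : Graph k) {u v} → NimEdge χ H u v → NimEdge χ H v u
nimEdge-sym χ H (u≢v , nim) = u≢v ∘ sym , nim ∘ inMonoCopy-sym {χ = χ} {H = H}

nimEdge-irrefl : ∀ {r k n} (χ : Colouring r n) (H : Graph k) u → ¬ NimEdge χ H u u
nimEdge-irrefl χ H u (u≢u , _) = u≢u refl

-- It is kept opaque: all that is used about it is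
-- that its adjacency is exactly NimEdge (this also keeps the type checker from
-- evaluating the decision procedure for monochromatic copies).
opaque
  nimGraph : ∀ {r k n} → Colouring r n → Graph k → Graph n
  nimGraph χ H = record
    { adj = λ u v → isYes (nimEdge? χ H u v)
    ; sym = λ u v → trans (isYes≗does (nimEdge? χ H u v))
        (trans (does-⇔ (mk⇔ (nimEdge-sym χ H) (nimEdge-sym χ H)) (nimEdge? χ H u v) (nimEdge? χ H v u))
               (sym (isYes≗does (nimEdge? χ H v u))))
    ; irrefl = λ u → trans (isYes≗does (nimEdge? χ H u u))
        (dec-false (nimEdge? χ H u u) (nimEdge-irrefl χ H u))
    }

  nimGraph-adj⁺ : ∀ {r k n} (χ : Colouring r n) (H : Graph k) {u v} →
    NimEdge χ H u v → T (adj (nimGraph χ H) u v)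
  nimGraph-adj⁺ χ H {u} {v} = fromWitness {a? = nimEdge? χ H u v}

  nimGraph-adj⁻ : ∀ {r k n} (χ : Colouring r n) (H : Graph k) {u v} →
    T (adj (nimGraph χ H) u v) → NimEdge χ H u v
  nimGraph-adj⁻ χ H {u} {v} = toWitness {a? = nimEdge? χ H u v}

nimCount-nimGraph : ∀ {r k n} (χ : Colouring r n) (H : Graph k) → NimCount χ H (edges (nimGraph χ H))
nimCount-nimGraph {n = n} χ H = edgeList G , edgeList-unique G , refl , λ u v → mk⇔
  (λ m → let u<v , uv = Equivalence.to (∈-edgeList G u v) m in u<v , proj₂ (nimGraph-adj⁻ χ H uv))
  (λ (u<v , nim) → Equivalence.from (∈-edgeList G u v) (u<v , nimGraph-adj⁺ χ H (<⇒≢ u<v , nim)))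
  where
  G : Graph n
  G = nimGraph χ H

nimCount-≤ : ∀ {r k n} {χ : Colouring r n} {H : Graph k} {m} → NimCount χ H m → m ≤ edges (nimGraph χ H)
nimCount-≤ {χ = χ} {H} (L , L-unique , refl , L-spec) = unique-⊆-length L-unique λ { {u , v} m →
  let u<v , nim = Equivalence.to (L-spec u v) m in
  Equivalence.from (∈-edgeList (nimGraph χ H) u v) (u<v , nimGraph-adj⁺ χ H (<⇒≢ u<v , nim)) }

◂-injective : ∀ {k n} {x : Fin n} {g : Fin k → Fin n} → (∀ i → g i ≢ x) →
  Injective _≡_ _≡_ g → Injective _≡_ _≡_ (x ◂ g)
◂-injective g≢x g-inj {F.zero} {F.zero} _ = refl
◂-injective g≢x g-inj {F.zero} {F.suc j} eq = ⊥-elim (g≢x j (sym eq))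
◂-injective g≢x g-inj {F.suc i} {F.zero} eq = ⊥-elim (g≢x i eq)
◂-injective g≢x g-inj {F.suc i} {F.suc j} eq = cong F.suc (g-inj eq)

module Neighbourhood {r n} (χ : Colouring r n) (c : Fin n) where

  Nbr : Fin r → Fin n → Set
  Nbr κ w = w ≢ c × col χ c w ≡ κ

  nbr? : ∀ κ w → Dec (Nbr κ w)
  nbr? κ w = ¬? (w ≟ c) ×-dec (col χ c w ≟ κ)

  nbrs : Fin r → List (Fin n)
  nbrs κ = filter (nbr? κ) (allFin n)

  nbrs-unique : ∀ κ → Unique (nbrs κ)
  nbrs-unique κ = Unique.filter⁺ (nbr? κ) (Unique.allFin⁺ n)

  ∈-nbrs⁻ : ∀ {κ w} → w ∈ nbrs κ → Nbr κ w
  ∈-nbrs⁻ {κ} m = proj₂ (∈-filter⁻ (nbr? κ) {xs = allFin n} m)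

  monoStar : ∀ {h κ} (ℓ : Fin h → Fin n) → Injective _≡_ _≡_ ℓ → (∀ i → Nbr κ (ℓ i)) →
    MonoCopy χ (star h) κ
  monoStar {h} {κ} ℓ ℓ-inj ℓ-nbr = c ◂ ℓ , ◂-injective (proj₁ ∘ ℓ-nbr) ℓ-inj , coloured
    where
    coloured : ∀ a b → T (adj (star h) a b) → col χ ((c ◂ ℓ) a) ((c ◂ ℓ) b) ≡ κ
    coloured F.zero (F.suc j) _ = proj₂ (ℓ-nbr j)
    coloured (F.suc i) F.zero _ = trans (colSym χ (ℓ i) c) (proj₂ (ℓ-nbr i))
    coloured F.zero F.zero ()
    coloured (F.suc i) (F.suc j) ()

  -- If c has more than h neighbours of colour κ, every κ-edge cw lies in a
  -- monochromatic K_{1,h+1}: take w together with h other κ-neighbours as leaves.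
  starThrough : ∀ {h κ w} → suc h ≤ length (nbrs κ) → Nbr κ w → InMonoCopy χ (star (suc h)) c w
  starThrough {h} {κ} {w} large w-nbr with pick (Unique.filter⁺ (λ x → ¬? (x ≟ w)) (nbrs-unique κ)) enough
    where
    others : List (Fin n)
    others = filter (λ x → ¬? (x ≟ w)) (nbrs κ)
    nbrs⊆w∷others : ∀ {x} → x ∈ nbrs κ → x ∈ w ∷ others
    nbrs⊆w∷others {x} m with x ≟ w
    ... | yes refl = here refl
    ... | no x≢w = there (∈-filter⁺ (λ x → ¬? (x ≟ w)) m x≢w)
    enough : h ≤ length others
    enough = ≤-pred (≤-trans large (unique-⊆-length (nbrs-unique κ) nbrs⊆w∷others))
  ... | g , g-inj , g∈others =
    κ , monoStar (w ◂ g) (◂-injective g≢w g-inj) leaf-nbr , F.zero , F.suc F.zero , tt , refl , refl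
    where
    g≢w : ∀ i → g i ≢ w
    g≢w i = proj₂ (∈-filter⁻ (λ x → ¬? (x ≟ w)) {xs = nbrs κ} (g∈others i))
    leaf-nbr : ∀ i → Nbr κ ((w ◂ g) i)
    leaf-nbr F.zero = w-nbr
    leaf-nbr (F.suc i) = ∈-nbrs⁻ (proj₁ (∈-filter⁻ (λ x → ¬? (x ≟ w)) {xs = nbrs κ} (g∈others i)))

red blue : Fin 2
red = F.zero
blue = F.suc F.zero

other-colour : ∀ {a b κ : Fin 2} → a ≢ κ → b ≢ κ → a ≡ b
other-colour {F.zero} {F.zero} _ _ = refl
other-colour {F.suc F.zero} {F.suc F.zero} _ _ = refl
other-colour {F.zero} {F.suc F.zero} {F.zero} a≢κ _ = ⊥-elim (a≢κ refl)
other-colour {F.zero} {F.suc F.zero} {F.suc F.zero} _ b≢κ = ⊥-elim (b≢κ refl)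
other-colour {F.suc F.zero} {F.zero} {F.zero} _ b≢κ = ⊥-elim (b≢κ refl)
other-colour {F.suc F.zero} {F.zero} {F.suc F.zero} a≢κ _ = ⊥-elim (a≢κ refl)

module _ {n} (χ : Colouring 2 n) (c : Fin n) where
  open Neighbourhood χ c

  -- Every vertex is c or lies in one of the two colour classes of c, so
  -- n ≤ 1 + |red class| + |blue class|.
  nbrs-cover : n ≤ suc (length (nbrs red) + length (nbrs blue))
  nbrs-cover = subst₂ _≤_ (length-tabulate (λ i → i)) (cong suc (length-++ (nbrs red)))
    (unique-⊆-length (Unique.allFin⁺ n) (λ {w} _ → classify w))
    where
    classify : ∀ w → w ∈ c ∷ nbrs red ++ nbrs blue
    classify w with w ≟ c | col χ c w in cw
    ... | yes refl | _ = here refl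
    ... | no w≢c | F.zero = there (∈-++⁺ˡ (∈-filter⁺ (nbr? red) (∈-allFin w) (w≢c , cw)))
    ... | no w≢c | F.suc F.zero =
      there (∈-++⁺ʳ (nbrs red) (∈-filter⁺ (nbr? blue) (∈-allFin w) (w≢c , cw)))

  large-class : ∀ {h} → suc h + suc h ≤ n → Σ (Fin 2) λ κ → suc h ≤ length (nbrs κ)
  large-class {h} large with suc h ≤? length (nbrs red) | suc h ≤? length (nbrs blue)
  ... | yes big | _ = red , big
  ... | no _ | yes big = blue , big
  ... | no small-red | no small-blue = ⊥-elim (1+n≰n (begin
    suc (suc (h + h))                            ≡⟨ cong suc (+-suc h h) ⟨
    suc h + suc h                                ≤⟨ large ⟩
    n                                            ≤⟨ nbrs-cover ⟩
    suc (length (nbrs red) + length (nbrs blue)) ≤⟨ s≤s (+-mono-≤ (≤-pred (≰⇒> small-red))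
                                                                  (≤-pred (≰⇒> small-blue))) ⟩
    suc (h + h)                                  ∎))
    where open ≤-Reasoning

-- At the centre
-- c of a would-be star, some colour κ has a large class, so by starThrough no
-- NIM edge at c has colour κ; hence all leaf edges share the other colour and
-- the star itself is monochromatic, so its edges are not NIM.
nimGraph-starFree : ∀ {h n} (χ : Colouring 2 n) → suc h + suc h ≤ n →
  HFree (star (suc h)) (nimGraph χ (star (suc h)))
nimGraph-starFree {h} {n} χ large (f , f-inj , f-nim) =
  nim F.zero (κ′ , (f , f-inj , coloured) , F.zero , F.suc F.zero , tt , refl , refl)
  where
  S : Graph (suc (suc h))
  S = star (suc h)
  c : Fin n
  c = f F.zero
  open Neighbourhood χ c
  nim : ∀ i → ¬ InMonoCopy χ S c (f (F.suc i))
  nim i = proj₂ (nimGraph-adj⁻ χ S (f-nim F.zero (F.suc i) tt))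
  leaf≢c : ∀ i → f (F.suc i) ≢ c
  leaf≢c i eq with f-inj eq
  ... | ()
  κ : Fin 2
  κ = proj₁ (large-class χ c large)
  avoids-κ : ∀ i → col χ c (f (F.suc i)) ≢ κ
  avoids-κ i cκ = nim i (starThrough (proj₂ (large-class χ c large)) (leaf≢c i , cκ))
  κ′ : Fin 2
  κ′ = col χ c (f (F.suc F.zero))
  coloured : ∀ a b → T (adj S a b) → col χ (f a) (f b) ≡ κ′
  coloured F.zero (F.suc j) _ = other-colour (avoids-κ j) (avoids-κ F.zero)
  coloured (F.suc j) F.zero _ = trans (colSym χ (f (F.suc j)) c) (other-colour (avoids-κ j) (avoids-κ F.zero))
  coloured F.zero F.zero ()
  coloured (F.suc i) (F.suc j) ()

graphColouring : ∀ {n} → Graph n → Colouring 2 n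
graphColouring G = record
  { col = λ u v → if adj G u v then red else blue
  ; colSym = λ u v → cong (λ b → if b then red else blue) (adj-sym G u v)
  }

red-is-edge : ∀ {n} (G : Graph n) u v → col (graphColouring G) u v ≡ red → T (adj G u v)
red-is-edge G u v red≡ with adj G u v
red-is-edge G u v red≡ | true = tt
red-is-edge G u v () | false

edge-is-red : ∀ {n} (G : Graph n) u v → T (adj G u v) → col (graphColouring G) u v ≡ red
edge-is-red G u v uv with adj G u v
... | true = refl

-- If G is H-free, every edge of G is NIM under its colouring: a monochromatic
-- copy of H through a red edge is red, i.e. a copy of H in G.
graph⊆nimGraph : ∀ {k n} {H : Graph k} (G : Graph n) → HFree H G →
  ∀ u v → T (adj G u v) → T (adj (nimGraph (graphColouring G) H) u v)
graph⊆nimGraph {H = H} G free u v uv = nimGraph-adj⁺ (graphColouring G) H (u≢v , nim)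
  where
  u≢v : u ≢ v
  u≢v refl = subst T (adj-irrefl G u) uv
  nim : ¬ InMonoCopy (graphColouring G) H u v
  nim (κ , (f , f-inj , f-mono) , a , b , ab , fa≡u , fb≡v) =
    free (f , f-inj , λ x y xy → red-is-edge G (f x) (f y) (trans (f-mono x y xy) κ≡red))
    where
    κ≡red : κ ≡ red
    κ≡red = trans (sym (f-mono a b ab))
      (subst₂ (λ x y → col (graphColouring G) x y ≡ red) (sym fa≡u) (sym fb≡v) (edge-is-red G u v uv))

-- For the star with h+1 leaves take n₀ = 2(h+1); the common value m is the
-- Turán number, attained by the colouring of an extremal graph.
proposition6p1 : ∀ (h : ℕ) → 1 ≤ h →
    Σ ℕ λ n₀ → ∀ n → n₀ ≤ n →
      Σ ℕ λ m → IsNim 2 n (star h) m × IsEx n (star h) m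
proposition6p1 zero ()
proposition6p1 (suc h) _ =
  suc h + suc h , λ n large → nim≡ex n large (ex-exists S (F.zero , F.suc F.zero , tt) n)
  where
  S : Graph (suc (suc h))
  S = star (suc h)
  nim≡ex : ∀ n → suc h + suc h ≤ n → Σ ℕ (IsEx n S) → Σ ℕ λ m → IsNim 2 n S m × IsEx n S m
  nim≡ex n large (m , ex@((G , G-free , G-edges) , maximal)) =
    m , ((χ , subst (NimCount χ S) nim-edges≡m (nimCount-nimGraph χ S)) , upper) , ex
    where
    χ : Colouring 2 n
    χ = graphColouring G
    upper : ∀ (χ′ : Colouring 2 n) m′ → NimCount χ′ S m′ → m′ ≤ m
    upper χ′ m′ count =
      ≤-trans (nimCount-≤ count) (maximal (nimGraph χ′ S) (nimGraph-starFree χ′ large))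
    nim-edges≡m : edges (nimGraph χ S) ≡ m
    nim-edges≡m = ≤-antisym (maximal (nimGraph χ S) (nimGraph-starFree χ large))
      (subst (_≤ edges (nimGraph χ S)) G-edges
        (edges-mono {G = G} {G′ = nimGraph χ S} (graph⊆nimGraph {H = S} G G-free)))
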